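{- For every integer $r\ge 0$ and every positive integer $n$, \[ S_{r+2}(n)=n^2\,S_r(n)-2n(2n-1)\,S_r(n-1), \] where $S_m(n)=\sum_{k=0}^{2n}\binom{2n}{k}\,|n-k|^{m}$.
   Context: For integers $m\ge 0$ and $n\ge 0$, $S_m(n)=\sum_{k=0}^{2n}\binom{2n}{k}|n-k|^m$, with the convention $0^0=1$ (so $S_0(0)=1$ and $S_m(0)=0$ for $m\ge1$). -}

module Defs where

open import Data.Nat using (ℕ; zero; suc; _+_; _*_; _^_; ∣_-_∣)
open import Data.Nat.Combinatorics using (_C_)
open import Data.List using (map; upTo)
open import Data.Nat.ListAction using (sum)

-- S m n = Σ_{k=0}^{2n} binom(2n,k) * |n - k|^m   (with 0^0 = 1, as for ℕ's _^_)
S : ℕ → ℕ → ℕ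
S m n = sum (map (λ k → ((2 * n) C k) * (∣ n - k ∣ ^ m)) (upTo (suc (2 * n))))

-- Write M = 2(n+1) and a = n + 1. Termwise, the binomial identity
-- k (M - k) C(M,k) = M (M-1) C(M-2,k-1) and the algebraic identity
-- (a - k)² + k (M - k) = a² give
--   C(M,k) |a-k|^(r+2) + M (M-1) C(M-2,k-1) |a-k|^r = a² C(M,k) |a-k|^r,
-- and summing over k turns the middle term into M (M-1) S_r(n), after the
-- index shift j = k - 1 (the terms k = 0 and k = M vanish).
module Submission where

open import Defs
open import Data.Nat using (ℕ; suc)
open import Relation.Binary.PropositionalEquality
  using (_≡_; refl; sym; trans; cong; cong₂; subst; module ≡-Reasoning)

module ℕ-Recurrence where

  open import Data.Nat using (zero; _+_; _*_; _∸_; _^_; ∣_-_∣; _≤_; _≤?_)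
  open import Data.Nat.Properties
  open import Data.Nat.Combinatorics using (_C_; nCk+nC[k+1]≡[n+1]C[k+1]; nC1≡n; nCk≡nC[n∸k])
  open import Data.Nat.Combinatorics.Specification using (k>n⇒nCk≡0)
  open import Data.Nat.ListAction using (sum)
  open import Data.Nat.Tactic.RingSolver using (solve-∀)
  open import Algebra.Properties.CommutativeSemigroup +-commutativeSemigroup using (interchange)
  open import Data.List using ([]; _∷_; _∷ʳ_; _++_; map; upTo; applyUpTo)
  open import Data.List.Properties using (map-cong; map-upTo; map-applyUpTo; map-++; upTo-∷ʳ)
  open import Data.Nat.ListAction.Properties using (sum-++)
  open import Data.Product using (_,_)
  open import Data.Sum using (inj₁; inj₂)
  open import Relation.Nullary using (yes; no)
  open import Function using (_∘_)
  open ≡-Reasoning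

  private
    variable
      A : Set

  sum-map-+ : ∀ (f g : A → ℕ) xs →
              sum (map (λ x → f x + g x) xs) ≡ sum (map f xs) + sum (map g xs)
  sum-map-+ f g []       = refl
  sum-map-+ f g (x ∷ xs) = begin
      f x + g x + sum (map (λ x → f x + g x) xs)
    ≡⟨ cong (f x + g x +_) (sum-map-+ f g xs) ⟩
      f x + g x + (sum (map f xs) + sum (map g xs))
    ≡⟨ interchange (f x) (g x) _ _ ⟩
      f x + sum (map f xs) + (g x + sum (map g xs)) ∎

  sum-map-*ˡ : ∀ c (f : A → ℕ) xs → sum (map (λ x → c * f x) xs) ≡ c * sum (map f xs)
  sum-map-*ˡ c f []       = sym (*-zeroʳ c)
  sum-map-*ˡ c f (x ∷ xs) = begin
      c * f x + sum (map (λ x → c * f x) xs) ≡⟨ cong (c * f x +_) (sum-map-*ˡ c f xs) ⟩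
      c * f x + c * sum (map f xs)           ≡⟨ *-distribˡ-+ c (f x) _ ⟨
      c * (f x + sum (map f xs))             ∎

  sum-map-upTo-suc : ∀ (f : ℕ → ℕ) n →
                     sum (map f (upTo (suc n))) ≡ f 0 + sum (map (f ∘ suc) (upTo n))
  sum-map-upTo-suc f n = cong (λ xs → f 0 + sum xs) (begin
      map f (applyUpTo suc n) ≡⟨ map-applyUpTo suc f n ⟩
      applyUpTo (f ∘ suc) n   ≡⟨ map-upTo (f ∘ suc) n ⟨
      map (f ∘ suc) (upTo n)  ∎)

  sum-map-upTo-∷ʳ : ∀ (f : ℕ → ℕ) n →
                    sum (map f (upTo (suc n))) ≡ sum (map f (upTo n)) + f n
  sum-map-upTo-∷ʳ f n = begin
      sum (map f (upTo (suc n)))         ≡⟨ cong (sum ∘ map f) (upTo-∷ʳ n) ⟨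
      sum (map f (upTo n ∷ʳ n))          ≡⟨ cong sum (map-++ f (upTo n) _) ⟩
      sum (map f (upTo n) ++ (f n ∷ [])) ≡⟨ sum-++ (map f (upTo n)) _ ⟩
      sum (map f (upTo n)) + (f n + 0)   ≡⟨ cong (sum (map f (upTo n)) +_) (+-identityʳ (f n)) ⟩
      sum (map f (upTo n)) + f n         ∎

  suc[m+n]∸m≡suc[n] : ∀ m n → suc (m + n) ∸ m ≡ suc n
  suc[m+n]∸m≡suc[n] m n = trans (cong (_∸ m) (sym (+-suc m n))) (m+n∸m≡n m (suc n))

  [1+k]*[1+n]C[1+k]≡[1+n]*nCk : ∀ n k → suc k * (suc n C suc k) ≡ suc n * (n C k)
  [1+k]*[1+n]C[1+k]≡[1+n]*nCk zero    zero    = refl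
  [1+k]*[1+n]C[1+k]≡[1+n]*nCk zero    (suc k) = *-zeroʳ (suc (suc k))
  [1+k]*[1+n]C[1+k]≡[1+n]*nCk (suc n) zero    = begin
      1 * (suc (suc n) C 1) ≡⟨ *-identityˡ _ ⟩
      suc (suc n) C 1       ≡⟨ nC1≡n (suc (suc n)) ⟩
      suc (suc n)           ≡⟨ *-identityʳ (suc (suc n)) ⟨
      suc (suc n) * 1       ∎
  [1+k]*[1+n]C[1+k]≡[1+n]*nCk (suc n) (suc k) = begin
      suc (suc k) * (suc (suc n) C suc (suc k))
    ≡⟨ cong (suc (suc k) *_) (nCk+nC[k+1]≡[n+1]C[k+1] (suc n) (suc k)) ⟨
      suc (suc k) * (X + Y)
    ≡⟨ regroupˡ k X Y ⟩
      suc k * X + X + suc (suc k) * Y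
    ≡⟨ cong₂ (λ u v → u + X + v) ([1+k]*[1+n]C[1+k]≡[1+n]*nCk n k)
                                 ([1+k]*[1+n]C[1+k]≡[1+n]*nCk n (suc k)) ⟩
      suc n * (n C k) + X + suc n * (n C suc k)
    ≡⟨ regroupʳ (suc n) (n C k) X (n C suc k) ⟩
      suc n * (n C k + n C suc k) + X
    ≡⟨ cong (λ u → suc n * u + X) (nCk+nC[k+1]≡[n+1]C[k+1] n k) ⟩
      suc n * X + X
    ≡⟨ +-comm (suc n * X) X ⟩
      suc (suc n) * X ∎
    where
    X = suc n C suc k
    Y = suc n C suc (suc k)
    regroupˡ : ∀ k x y → suc (suc k) * (x + y) ≡ suc k * x + x + suc (suc k) * y
    regroupˡ = solve-∀
    regroupʳ : ∀ m u x v → m * u + x + m * v ≡ m * (u + v) + x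
    regroupʳ = solve-∀

  [1+i]*[1+j+i]Cj≡[1+j+i]*[j+i]Cj : ∀ j i → suc i * (suc (j + i) C j) ≡ suc (j + i) * ((j + i) C j)
  [1+i]*[1+j+i]Cj≡[1+j+i]*[j+i]Cj j i = begin
      suc i * (suc (j + i) C j)
    ≡⟨ cong (suc i *_) (nCk≡nC[n∸k] (m≤n⇒m≤1+n (m≤m+n j i))) ⟩
      suc i * (suc (j + i) C (suc (j + i) ∸ j))
    ≡⟨ cong (λ l → suc i * (suc (j + i) C l)) (suc[m+n]∸m≡suc[n] j i) ⟩
      suc i * (suc (j + i) C suc i)
    ≡⟨ [1+k]*[1+n]C[1+k]≡[1+n]*nCk (j + i) i ⟩
      suc (j + i) * ((j + i) C i)
    ≡⟨ cong (suc (j + i) *_) (nCk≡nC[n∸k] (m≤n+m i j)) ⟩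
      suc (j + i) * ((j + i) C (j + i ∸ i))
    ≡⟨ cong (λ l → suc (j + i) * ((j + i) C l)) (m+n∸n≡m j i) ⟩
      suc (j + i) * ((j + i) C j)
    ∎

  [1+j]*[1+i]*[2+j+i]C[1+j]≡[2+j+i]*[1+j+i]*[j+i]Cj : ∀ j i →
    suc j * suc i * (suc (suc (j + i)) C suc j) ≡ suc (suc (j + i)) * suc (j + i) * ((j + i) C j)
  [1+j]*[1+i]*[2+j+i]C[1+j]≡[2+j+i]*[1+j+i]*[j+i]Cj j i = begin
      suc j * suc i * (N C suc j)       ≡⟨ swapˡ (suc j) (suc i) (N C suc j) ⟩
      suc i * (suc j * (N C suc j))     ≡⟨ cong (suc i *_) ([1+k]*[1+n]C[1+k]≡[1+n]*nCk (suc (j + i)) j) ⟩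
      suc i * (N * (suc (j + i) C j))   ≡⟨ swapʳ (suc i) N (suc (j + i) C j) ⟩
      N * (suc i * (suc (j + i) C j))   ≡⟨ cong (N *_) ([1+i]*[1+j+i]Cj≡[1+j+i]*[j+i]Cj j i) ⟩
      N * (suc (j + i) * ((j + i) C j)) ≡⟨ *-assoc N (suc (j + i)) _ ⟨
      N * suc (j + i) * ((j + i) C j)   ∎
    where
    N = suc (suc (j + i))
    swapˡ : ∀ a b x → a * b * x ≡ b * (a * x)
    swapˡ = solve-∀
    swapʳ : ∀ a b x → a * (b * x) ≡ b * (a * x)
    swapʳ = solve-∀

  -- m C (k - 1), taking the value 0 at k = 0 where m C (k ∸ 1) would give 1.
  infixl 6.5 _C[-1+_]

  _C[-1+_] : ℕ → ℕ → ℕ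
  m C[-1+ zero  ] = 0
  m C[-1+ suc k ] = m C k

  k*[2+m∸k]*[2+m]Ck≡[2+m]*[1+m]*mC[k-1] : ∀ m k →
    k * (suc (suc m) ∸ k) * (suc (suc m) C k) ≡ suc (suc m) * suc m * (m C[-1+ k ])
  k*[2+m∸k]*[2+m]Ck≡[2+m]*[1+m]*mC[k-1] m zero = sym (*-zeroʳ (suc (suc m) * suc m))
  k*[2+m∸k]*[2+m]Ck≡[2+m]*[1+m]*mC[k-1] m (suc j) with j ≤? m
  ... | yes j≤m with m≤n⇒∃[o]m+o≡n j≤m
  ...   | i , refl =
    trans (cong (λ l → suc j * l * (suc (suc (j + i)) C suc j)) (suc[m+n]∸m≡suc[n] j i))
          ([1+j]*[1+i]*[2+j+i]C[1+j]≡[2+j+i]*[1+j+i]*[j+i]Cj j i)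
  k*[2+m∸k]*[2+m]Ck≡[2+m]*[1+m]*mC[k-1] m (suc j) | no j≰m = begin
      suc j * (suc m ∸ j) * X        ≡⟨ cong (λ l → suc j * l * X) (m≤n⇒m∸n≡0 (≰⇒> j≰m)) ⟩
      suc j * 0 * X                  ≡⟨ cong (_* X) (*-zeroʳ (suc j)) ⟩
      0                              ≡⟨ *-zeroʳ (suc (suc m) * suc m) ⟨
      suc (suc m) * suc m * 0        ≡⟨ cong (suc (suc m) * suc m *_) (k>n⇒nCk≡0 (≰⇒> j≰m)) ⟨
      suc (suc m) * suc m * (m C j)  ∎
    where
    X = suc (suc m) C suc j

  ∣m-n∣²+2mn≡m²+n² : ∀ m n → ∣ m - n ∣ * ∣ m - n ∣ + 2 * (m * n) ≡ m * m + n * n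
  ∣m-n∣²+2mn≡m²+n² m n with ≤-total m n
  ... | inj₁ m≤n with m≤n⇒∃[o]m+o≡n m≤n
  ...   | e , refl = trans (cong (λ d → d * d + 2 * (m * (m + e))) (∣m-m+n∣≡n m e)) (expand m e)
    where
    expand : ∀ m e → e * e + 2 * (m * (m + e)) ≡ m * m + (m + e) * (m + e)
    expand = solve-∀
  ∣m-n∣²+2mn≡m²+n² m n | inj₂ n≤m with m≤n⇒∃[o]m+o≡n n≤m
  ...   | e , refl = trans (cong (λ d → d * d + 2 * ((n + e) * n)) ∣n+e-n∣≡e) (expand n e)
    where
    ∣n+e-n∣≡e : ∣ n + e - n ∣ ≡ e
    ∣n+e-n∣≡e = trans (∣-∣-comm (n + e) n) (∣m-m+n∣≡n n e)
    expand : ∀ n e → e * e + 2 * ((n + e) * n) ≡ (n + e) * (n + e) + n * n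
    expand = solve-∀

  ∣a-k∣²+k[2a∸k]≡a² : ∀ a k → k ≤ 2 * a → ∣ a - k ∣ * ∣ a - k ∣ + k * (2 * a ∸ k) ≡ a * a
  ∣a-k∣²+k[2a∸k]≡a² a k k≤2a = +-cancelʳ-≡ (k * k) _ _ (begin
      d * d + k * (2 * a ∸ k) + k * k   ≡⟨ +-assoc (d * d) _ _ ⟩
      d * d + (k * (2 * a ∸ k) + k * k) ≡⟨ cong (d * d +_) (*-distribˡ-+ k (2 * a ∸ k) k) ⟨
      d * d + k * (2 * a ∸ k + k)       ≡⟨ cong (λ x → d * d + k * x) (m∸n+n≡m k≤2a) ⟩
      d * d + k * (2 * a)               ≡⟨ cong (d * d +_) (reorder k a) ⟩
      d * d + 2 * (a * k)               ≡⟨ ∣m-n∣²+2mn≡m²+n² a k ⟩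
      a * a + k * k                     ∎)
    where
    d = ∣ a - k ∣
    reorder : ∀ k a → k * (2 * a) ≡ 2 * (a * k)
    reorder = solve-∀

  [2a]Ck*[∣a-k∣²+k[2a∸k]]≡[2a]Ck*a² : ∀ a k →
    ((2 * a) C k) * (∣ a - k ∣ * ∣ a - k ∣ + k * (2 * a ∸ k)) ≡ ((2 * a) C k) * (a * a)
  [2a]Ck*[∣a-k∣²+k[2a∸k]]≡[2a]Ck*a² a k with k ≤? 2 * a
  ... | yes k≤2a = cong (((2 * a) C k) *_) (∣a-k∣²+k[2a∸k]≡a² a k k≤2a)
  ... | no k≰2a rewrite k>n⇒nCk≡0 (≰⇒> k≰2a) = refl

  S-summand : ℕ → ℕ → ℕ → ℕ
  S-summand r n k = ((2 * n) C k) * (∣ n - k ∣ ^ r)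

  S-shifted-summand : ℕ → ℕ → ℕ → ℕ
  S-shifted-summand r n k = ((2 * n) C[-1+ k ]) * (∣ suc n - k ∣ ^ r)

  S-summand-recurrence : ∀ r n k →
    S-summand (suc (suc r)) (suc n) k + 2 * suc n * suc (2 * n) * S-shifted-summand r n k
    ≡ suc n * suc n * S-summand r (suc n) k
  S-summand-recurrence r n k = begin
      b * (d * (d * e)) + M * suc m * (b′ * e) ≡⟨ cong (b * (d * (d * e)) +_) (*-assoc (M * suc m) b′ e) ⟨
      b * (d * (d * e)) + M * suc m * b′ * e  ≡⟨ cong (λ x → b * (d * (d * e)) + x * e) absorbed ⟨
      b * (d * (d * e)) + k * (M ∸ k) * b * e ≡⟨ factor b d e k (M ∸ k) ⟩
      b * (d * d + k * (M ∸ k)) * e           ≡⟨ cong (_* e) ([2a]Ck*[∣a-k∣²+k[2a∸k]]≡[2a]Ck*a² a k) ⟩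
      b * (a * a) * e                         ≡⟨ reorder b (a * a) e ⟩
      a * a * (b * e)                         ∎
    where
    a = suc n
    m = 2 * n
    M = 2 * a
    b = M C k
    b′ = m C[-1+ k ]
    d = ∣ a - k ∣
    e = d ^ r
    absorbed : k * (M ∸ k) * b ≡ M * suc m * b′
    absorbed = subst (λ N → k * (N ∸ k) * (N C k) ≡ N * suc m * b′) (sym (*-suc 2 n))
                     (k*[2+m∸k]*[2+m]Ck≡[2+m]*[1+m]*mC[k-1] m k)
    factor : ∀ c d e k l → c * (d * (d * e)) + k * l * c * e ≡ c * (d * d + k * l) * e
    factor = solve-∀
    reorder : ∀ c s e → c * s * e ≡ s * (c * e)
    reorder = solve-∀

  sum-S-shifted-summand : ∀ r n →
    sum (map (S-shifted-summand r n) (upTo (suc (2 * suc n)))) ≡ S r n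
  sum-S-shifted-summand r n = begin
      sum (map f (upTo (suc (2 * suc n))))               ≡⟨ cong (λ N → sum (map f (upTo (suc N)))) (*-suc 2 n) ⟩
      sum (map f (upTo (suc (suc (suc m)))))             ≡⟨ sum-map-upTo-∷ʳ f (suc (suc m)) ⟩
      sum (map f (upTo (suc (suc m)))) + f (suc (suc m)) ≡⟨ cong₂ _+_ (sum-map-upTo-suc f (suc m)) last-vanishes ⟩
      sum (map (f ∘ suc) (upTo (suc m))) + 0             ≡⟨ +-identityʳ _ ⟩
      S r n                                              ∎
    where
    m = 2 * n
    f = S-shifted-summand r n
    last-vanishes : f (suc (suc m)) ≡ 0
    last-vanishes = cong (_* (∣ n - suc m ∣ ^ r)) (k>n⇒nCk≡0 (n<1+n m))

  S-recurrence : ∀ r n → S (suc (suc r)) (suc n) + 2 * suc n * suc (2 * n) * S r n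
                         ≡ suc n * suc n * S r (suc n)
  S-recurrence r n = begin
      S (suc (suc r)) a + c * S r n
    ≡⟨ cong (λ x → S (suc (suc r)) a + c * x) (sum-S-shifted-summand r n) ⟨
      Σ (S-summand (suc (suc r)) a) + c * Σ (S-shifted-summand r n)
    ≡⟨ cong (Σ (S-summand (suc (suc r)) a) +_) (sum-map-*ˡ c (S-shifted-summand r n) ks) ⟨
      Σ (S-summand (suc (suc r)) a) + Σ (λ k → c * S-shifted-summand r n k)
    ≡⟨ sum-map-+ (S-summand (suc (suc r)) a) (λ k → c * S-shifted-summand r n k) ks ⟨
      Σ (λ k → S-summand (suc (suc r)) a k + c * S-shifted-summand r n k)
    ≡⟨ cong sum (map-cong (S-summand-recurrence r n) ks) ⟩
      Σ (λ k → a * a * S-summand r a k)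
    ≡⟨ sum-map-*ˡ (a * a) (S-summand r a) ks ⟩
      a * a * S r a
    ∎
    where
    a = suc n
    c = 2 * a * suc (2 * n)
    ks = upTo (suc (2 * a))
    Σ : (ℕ → ℕ) → ℕ
    Σ f = sum (map f ks)

open ℕ-Recurrence using (S-recurrence)
import Data.Nat as ℕ
open import Data.Integer using (ℤ; +_; _+_; _-_; _*_)
open import Data.Integer.Properties using (pos-*)
open import Data.Integer.Tactic.RingSolver using (solve-∀)
open ≡-Reasoning

+[1+2n]≡2[1+n]-1 : ∀ n → + suc (2 ℕ.* n) ≡ + 2 * + suc n - + 1
+[1+2n]≡2[1+n]-1 n = begin
    + 1 + + (2 ℕ.* n)       ≡⟨ cong (_+_ (+ 1)) (pos-* 2 n) ⟩
    + 1 + + 2 * + n         ≡⟨ expand (+ n) ⟩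
    + 2 * (+ 1 + + n) - + 1 ∎
  where
  expand : ∀ i → + 1 + + 2 * i ≡ + 2 * (+ 1 + i) - + 1
  expand = solve-∀

S-recurrence-ℤ : ∀ r n →
  + S (suc (suc r)) (suc n) + + 2 * + suc n * (+ 2 * + suc n - + 1) * + S r n
  ≡ + suc n * + suc n * + S r (suc n)
S-recurrence-ℤ r n = begin
    + A + + 2 * + a * (+ 2 * + a - + 1) * + B ≡⟨ cong (λ x → + A + + 2 * + a * x * + B) (+[1+2n]≡2[1+n]-1 n) ⟨
    + A + + 2 * + a * + s * + B               ≡⟨ cong (λ x → + A + x * + s * + B) (pos-* 2 a) ⟨
    + A + + (2 ℕ.* a) * + s * + B             ≡⟨ cong (λ x → + A + x * + B) (pos-* (2 ℕ.* a) s) ⟨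
    + A + + (2 ℕ.* a ℕ.* s) * + B             ≡⟨ cong (_+_ (+ A)) (pos-* (2 ℕ.* a ℕ.* s) B) ⟨
    + (A ℕ.+ 2 ℕ.* a ℕ.* s ℕ.* B)             ≡⟨ cong +_ (S-recurrence r n) ⟩
    + (a ℕ.* a ℕ.* C)                         ≡⟨ pos-* (a ℕ.* a) C ⟩
    + (a ℕ.* a) * + C                         ≡⟨ cong (_* + C) (pos-* a a) ⟩
    + a * + a * + C                           ∎
  where
  a = suc n
  s = suc (2 ℕ.* n)
  A = S (suc (suc r)) a
  B = S r n
  C = S r a

mainTheorem2 : ∀ (r n : ℕ) →
    + S (suc (suc r)) (suc n)
      ≡ (+ suc n) * (+ suc n) * (+ S r (suc n))
        - (+ 2) * (+ suc n) * ((+ 2) * (+ suc n) - (+ 1)) * (+ S r n)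
mainTheorem2 r n = begin
    + S (suc (suc r)) (suc n)             ≡⟨ i≡i+j-j (+ S (suc (suc r)) (suc n)) T ⟩
    + S (suc (suc r)) (suc n) + T - T     ≡⟨ cong (_- T) (S-recurrence-ℤ r n) ⟩
    + suc n * + suc n * + S r (suc n) - T ∎
  where
  T = + 2 * + suc n * (+ 2 * + suc n - + 1) * + S r n
  i≡i+j-j : ∀ i j → i ≡ i + j - j
  i≡i+j-j = solve-∀
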